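{- Let $h\ge 2$ and $n\ge 1$ be integers and let $H$ be an $h$-uniform hypergraph. If $H$ is $n$-e.c., then for each vertex $v\in V(H)$, the hypergraph $H[A(v)]$ is $(n-1)$-e.c.
   Context: A hypergraph $H=(V,E)$ consists of a finite vertex set $V$ and a collection $E$ of subsets of $V$ (edges); it is $h$-uniform if every edge has exactly $h$ vertices. For a positive integer $n$, an $h$-uniform hypergraph $H$ is $n$-existentially closed ($n$-e.c.) if for every set $S\subseteq V(H)$ with $|S|=n$ and every $T\subseteq S$, there is a set $X\subseteq V(H)\setminus S$ with $|X|=h-1$ such that $X\cup\{z\}$ is an edge of $H$ for every $z\in T$ and $X\cup\{s\}$ is not an edge of $H$ for every $s\in S\setminus T$. The $h$-uniform complement $H^\mathsf{c}$ is the hypergraph on $V(H)$ whose edges are the $h$-subsets of $V(H)$ that are not edges of $H$. For $v\in V(H)$, $A(v)$ is the set of all vertices that occur together with $v$ in at least one edge of $H^\mathsf{c}$. For $Y\subseteq V(H)$, $H[Y]$ is the hypergraph with vertex set $Y$ whose edges are the edges of $H$ contained in $Y$. -}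

module Defs where

open import Data.Nat using (ℕ; _∸_)
open import Data.Fin using (Fin)
open import Data.Fin.Subset using (Subset; _∈_; _∉_; _⊆_; _∪_; _─_; ⁅_⁆; ∣_∣)
open import Data.Product using (Σ; ∃-syntax; _×_; proj₂)
open import Relation.Binary.PropositionalEquality using (_≡_; _≢_)
open import Relation.Nullary using (¬_)

record Hypergraph (m : ℕ) : Set₁ where
  field
    V     : Subset m
    Edge  : Subset m → Set
    edge⊆ : ∀ e → Edge e → e ⊆ V

open Hypergraph public

Uniform : ∀ {m} → ℕ → Hypergraph m → Set
Uniform h H = ∀ e → Edge H e → ∣ e ∣ ≡ h

IsEC : ∀ {m} → ℕ → ℕ → Hypergraph m → Set
IsEC {m} h n H =
  ∀ (S : Subset m) → S ⊆ V H → ∣ S ∣ ≡ n →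
  ∀ (T : Subset m) → T ⊆ S →
  ∃[ X ] (X ⊆ (V H ─ S) × ∣ X ∣ ≡ h ∸ 1 ×
          (∀ z → z ∈ T → Edge H (X ∪ ⁅ z ⁆)) ×
          (∀ s → s ∈ S → s ∉ T → ¬ Edge H (X ∪ ⁅ s ⁆)))

CoEdge : ∀ {m} → ℕ → Hypergraph m → Subset m → Set
CoEdge h H e = e ⊆ V H × ∣ e ∣ ≡ h × ¬ Edge H e

InA : ∀ {m} → ℕ → Hypergraph m → Fin m → Fin m → Set
InA {m} h H v u = u ≢ v × ∃[ e ] (CoEdge h H e × v ∈ e × u ∈ e)

IsA : ∀ {m} → ℕ → Hypergraph m → Fin m → Subset m → Set
IsA {m} h H v A = ∀ (u : Fin m) → (u ∈ A → InA h H v u) × (InA h H v u → u ∈ A)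

Induced : ∀ {m} → (H : Hypergraph m) → (Y : Subset m) → Hypergraph m
Induced H Y = record
  { V = Y
  ; Edge = λ e → Edge H e × e ⊆ Y
  ; edge⊆ = λ e p → proj₂ p }

-- Extend S ⊆ A(v) by v and apply the n-e.c. property with the same T.
-- Since v ∉ T, the witness X makes X ∪ {v} a non-edge of size h, i.e. an
-- edge of the complement through v; hence X ⊆ A(v), so X already lies in
-- H[A(v)] and witnesses (n−1)-e.c. there for (S, T).
module Submission where

open import Defs
open import Data.Nat using (ℕ; suc; _≤_; _∸_; s≤s)
open import Data.Fin using (Fin)
open import Data.Fin.Subset
  using (Subset; inside; outside; _∈_; _∉_; _⊆_; _∪_; _─_; ⁅_⁆; ∣_∣)
open import Data.Fin.Subset.Properties
  using ( x∈⁅x⁆; x∈⁅y⁆⇒x≡y; ∪-identityʳ; p⊆p∪q; q⊆p∪q; x∈p∪q⁻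
        ; p─q⊆p; x∈p∧x∉q⇒x∈p─q; ⊆-trans)
open import Data.Vec using (_∷_; here; there)
open import Data.Product using (_,_; proj₁; proj₂; _×_)
open import Data.Sum using ([_,_]′)
open import Function using (_∘_)
open import Relation.Binary.PropositionalEquality using (_≡_; refl; sym; trans; cong; subst)
open import Relation.Nullary using (¬_; contradiction)

∣p∪⁅x⁆∣≡1+∣p∣ : ∀ {n} (p : Subset n) {x : Fin n} → x ∉ p → ∣ p ∪ ⁅ x ⁆ ∣ ≡ suc ∣ p ∣
∣p∪⁅x⁆∣≡1+∣p∣ (inside  ∷ p) {Fin.zero}  x∉p = contradiction here x∉p
∣p∪⁅x⁆∣≡1+∣p∣ (outside ∷ p) {Fin.zero}  x∉p = cong (suc ∘ ∣_∣) (∪-identityʳ p)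
∣p∪⁅x⁆∣≡1+∣p∣ (inside  ∷ p) {Fin.suc x} x∉p = cong suc (∣p∪⁅x⁆∣≡1+∣p∣ p (x∉p ∘ there))
∣p∪⁅x⁆∣≡1+∣p∣ (outside ∷ p) {Fin.suc x} x∉p = ∣p∪⁅x⁆∣≡1+∣p∣ p (x∉p ∘ there)

x∈p─q⇒x∉q : ∀ {n} (p q : Subset n) {x : Fin n} → x ∈ p ─ q → x ∉ q
x∈p─q⇒x∉q (_ ∷ p) (inside  ∷ q) ()        here
x∈p─q⇒x∉q (_ ∷ p) (outside ∷ q) here      ()
x∈p─q⇒x∉q (_ ∷ p) (_       ∷ q) (there i) (there j) = x∈p─q⇒x∉q p q i j

p∪⁅x⁆⊆q : ∀ {n} {p q : Subset n} {x : Fin n} → p ⊆ q → x ∈ q → p ∪ ⁅ x ⁆ ⊆ q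
p∪⁅x⁆⊆q {p = p} {x = x} p⊆q x∈q y∈ =
  [ p⊆q , (λ y∈⁅x⁆ → subst (_∈ _) (sym (x∈⁅y⁆⇒x≡y x y∈⁅x⁆)) x∈q) ]′ (x∈p∪q⁻ p ⁅ x ⁆ y∈)

ECWitness : ∀ {m} → ℕ → Hypergraph m → (S T X : Subset m) → Set
ECWitness h H S T X =
  X ⊆ (V H ─ S) × ∣ X ∣ ≡ h ∸ 1 ×
  (∀ z → z ∈ T → Edge H (X ∪ ⁅ z ⁆)) ×
  (∀ s → s ∈ S → s ∉ T → ¬ Edge H (X ∪ ⁅ s ⁆))

module _ {m} {h : ℕ} (H : Hypergraph m) {v : Fin m} {A : Subset m}
         (isA : IsA h H v A) where

  v∉A : v ∉ A
  v∉A v∈A = proj₁ (proj₁ (isA v) v∈A) refl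

  A⊆V : A ⊆ V H
  A⊆V {u} u∈A with proj₁ (isA u) u∈A
  ... | _ , e , (e⊆V , _) , _ , u∈e = e⊆V u∈e

  coEdge-∪⁅v⁆⇒⊆A : ∀ {X} → v ∉ X → CoEdge h H (X ∪ ⁅ v ⁆) → X ⊆ A
  coEdge-∪⁅v⁆⇒⊆A {X} v∉X co {u} u∈X = proj₂ (isA u)
    ( (λ { refl → v∉X u∈X })
    , X ∪ ⁅ v ⁆ , co , q⊆p∪q X ⁅ v ⁆ (x∈⁅x⁆ v) , p⊆p∪q ⁅ v ⁆ u∈X )

witness⇒coEdge-∪⁅v⁆ : ∀ {m k} {H : Hypergraph m} {S T X : Subset m} {v : Fin m} →
  v ∈ V H → v ∈ S → v ∉ T → ECWitness (suc k) H S T X → CoEdge (suc k) H (X ∪ ⁅ v ⁆)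
witness⇒coEdge-∪⁅v⁆ {H = H} {S} {X = X} v∈V v∈S v∉T (X⊆V─S , ∣X∣≡k , _ , nonedge) =
  p∪⁅x⁆⊆q (⊆-trans X⊆V─S (p─q⊆p (V H) S)) v∈V
  , trans (∣p∪⁅x⁆∣≡1+∣p∣ X (λ v∈X → x∈p─q⇒x∉q (V H) S (X⊆V─S v∈X) v∈S)) (cong suc ∣X∣≡k)
  , nonedge _ v∈S v∉T

witness-∪⁅v⁆⇒witness-induced :
  ∀ {m k} {H : Hypergraph m} {v : Fin m} {A S T X : Subset m} →
  IsA (suc k) H v A → v ∈ V H → S ⊆ A → T ⊆ S →
  ECWitness (suc k) H (S ∪ ⁅ v ⁆) T X → ECWitness (suc k) (Induced H A) S T X
witness-∪⁅v⁆⇒witness-induced {H = H} {v} {A} {S} {T} {X}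
  isA v∈V S⊆A T⊆S w@(X⊆V─S∪v , ∣X∣≡k , edge , nonedge) =
  (λ u∈X → x∈p∧x∉q⇒x∈p─q (X⊆A u∈X) (∉S∪v u∈X ∘ p⊆p∪q ⁅ v ⁆))
  , ∣X∣≡k
  , (λ z z∈T → edge z z∈T , p∪⁅x⁆⊆q X⊆A (S⊆A (T⊆S z∈T)))
  , (λ s s∈S s∉T → nonedge s (p⊆p∪q ⁅ v ⁆ s∈S) s∉T ∘ proj₁)
  where
  v∈S∪v : v ∈ S ∪ ⁅ v ⁆
  v∈S∪v = q⊆p∪q S ⁅ v ⁆ (x∈⁅x⁆ v)

  ∉S∪v : ∀ {u} → u ∈ X → u ∉ S ∪ ⁅ v ⁆
  ∉S∪v u∈X = x∈p─q⇒x∉q (V H) (S ∪ ⁅ v ⁆) (X⊆V─S∪v u∈X)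

  X⊆A : X ⊆ A
  X⊆A = coEdge-∪⁅v⁆⇒⊆A H isA (λ v∈X → ∉S∪v v∈X v∈S∪v)
          (witness⇒coEdge-∪⁅v⁆ {H = H} v∈V v∈S∪v (v∉A H isA ∘ S⊆A ∘ T⊆S) w)

theorem6 : ∀ {m : ℕ} (h n : ℕ) → 2 ≤ h → 1 ≤ n →
    (H : Hypergraph m) → Uniform h H → IsEC h n H →
    ∀ (v : Fin m) → v ∈ V H → (A : Subset m) → IsA h H v A →
    IsEC h (n ∸ 1) (Induced H A)
theorem6 h (suc n) (s≤s _) _ H _ ec v v∈V A isA S S⊆A ∣S∣≡n T T⊆S =
  let X , w = ec (S ∪ ⁅ v ⁆) S∪v⊆V ∣S∪v∣ T (p⊆p∪q ⁅ v ⁆ ∘ T⊆S)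
  in  X , witness-∪⁅v⁆⇒witness-induced {H = H} isA v∈V S⊆A T⊆S w
  where
  S∪v⊆V : S ∪ ⁅ v ⁆ ⊆ V H
  S∪v⊆V = p∪⁅x⁆⊆q (A⊆V H isA ∘ S⊆A) v∈V

  ∣S∪v∣ : ∣ S ∪ ⁅ v ⁆ ∣ ≡ suc n
  ∣S∪v∣ = trans (∣p∪⁅x⁆∣≡1+∣p∣ S (v∉A H isA ∘ S⊆A)) (cong suc ∣S∣≡n)
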